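{- Let $\mathbf{Q}$ be a QB-algebra and $x$ a regular element of $\mathbf{Q}$. Then $(cl(x))^{*}=cl(x^{*})$, where $(cl(x))^{*}=\{y^{*}: y\in cl(x)\}$.
   Context: A quasi-lattice is an algebra $\langle L;\vee,\wedge\rangle$ such that for all $x,y,z$: $\vee,\wedge$ are commutative and associative; $x\vee(x\wedge y)=x\vee x$ and $x\wedge(x\vee y)=x\wedge x$; $x\vee(y\vee y)=x\vee y$ and $x\wedge(y\wedge y)=x\wedge y$; $x\vee x=x\wedge x$; distributive if both distributive laws hold. A QB-algebra is an algebra $\langle Q;\vee,\wedge,{}^{*},0,1\rangle$ of type $\langle 2,2,1,0,0\rangle$ such that $\langle Q;\vee,\wedge\rangle$ is a distributive quasi-lattice and for all $x$: $x\vee 1=1$, $x\wedge 0=0$, $x\vee x^{*}=1$, $x\wedge x^{*}=0$, $(x\wedge x)^{*}=x^{*}\vee x^{*}$, $x^{**}=x$. An element $x$ is regular if $x\vee x=x$. For a regular element $x$, $cl(x)=\{y\in Q: y\vee y=x\vee x\}$ (the cloud of $x$). -}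

module Defs where

open import Level using (Level; suc; _⊔_)
open import Relation.Binary.PropositionalEquality using (_≡_)
open import Data.Product using (Σ; _×_; ∃)

record QBAlgebra (c : Level) : Set (suc c) where
  infixr 6 _∨_
  infixr 7 _∧_
  field
    Carrier : Set c
    _∨_ _∧_ : Carrier → Carrier → Carrier
    _* : Carrier → Carrier
    𝟘 𝟙 : Carrier
    ∨-comm : ∀ x y → x ∨ y ≡ y ∨ x
    ∧-comm : ∀ x y → x ∧ y ≡ y ∧ x
    ∨-assoc : ∀ x y z → (x ∨ y) ∨ z ≡ x ∨ (y ∨ z)
    ∧-assoc : ∀ x y z → (x ∧ y) ∧ z ≡ x ∧ (y ∧ z)
    ∨-absorb : ∀ x y → x ∨ (x ∧ y) ≡ x ∨ x
    ∧-absorb : ∀ x y → x ∧ (x ∨ y) ≡ x ∧ x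
    ∨-idem-r : ∀ x y → x ∨ (y ∨ y) ≡ x ∨ y
    ∧-idem-r : ∀ x y → x ∧ (y ∧ y) ≡ x ∧ y
    ∨∧-same : ∀ x → x ∨ x ≡ x ∧ x
    ∧-distrib-∨ : ∀ x y z → x ∧ (y ∨ z) ≡ (x ∧ y) ∨ (x ∧ z)
    ∨-distrib-∧ : ∀ x y z → x ∨ (y ∧ z) ≡ (x ∨ y) ∧ (x ∨ z)
    ∨-𝟙 : ∀ x → x ∨ 𝟙 ≡ 𝟙
    ∧-𝟘 : ∀ x → x ∧ 𝟘 ≡ 𝟘
    ∨-compl : ∀ x → x ∨ (x *) ≡ 𝟙
    ∧-compl : ∀ x → x ∧ (x *) ≡ 𝟘
    *-∧∧ : ∀ x → (x ∧ x) * ≡ (x *) ∨ (x *)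
    *-invol : ∀ x → (x *) * ≡ x

module _ {c : Level} (Q : QBAlgebra c) where
  open QBAlgebra Q

  Regular : Carrier → Set c
  Regular x = x ∨ x ≡ x

  cl : Carrier → Carrier → Set c
  cl x y = y ∨ y ≡ x ∨ x

  star-image : (Carrier → Set c) → Carrier → Set c
  star-image S z = Σ Carrier (λ y → S y × (y *) ≡ z)

  SameSet : (Carrier → Set c) → (Carrier → Set c) → Set c
  SameSet S T = (∀ z → S z → T z) × (∀ z → T z → S z)

module Submission where

open import Defs
open import Level using (Level)
open import Relation.Binary.PropositionalEquality
open import Data.Product using (_,_)

-- Complementation sends y ∨ y to y* ∨ y*, so y ↦ y* maps the cloud of x into the
-- cloud of x*; being an involution it is then onto.

module _ {c : Level} (Q : QBAlgebra c) where
  open QBAlgebra Q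

  *-∨∨ : ∀ y → (y ∨ y) * ≡ (y *) ∨ (y *)
  *-∨∨ y = trans (cong _* (∨∧-same y)) (*-∧∧ y)

  cl-* : ∀ x y → cl Q x y → cl Q (x *) (y *)
  cl-* x y y∈clx = begin
    (y *) ∨ (y *)  ≡⟨ sym (*-∨∨ y) ⟩
    (y ∨ y) *      ≡⟨ cong _* y∈clx ⟩
    (x ∨ x) *      ≡⟨ *-∨∨ x ⟩
    (x *) ∨ (x *)  ∎
    where open ≡-Reasoning

  star-image-cl : ∀ x → SameSet Q (star-image Q (cl Q x)) (cl Q (x *))
  star-image-cl x = image⊆ , ⊆image
    where
    image⊆ : ∀ z → star-image Q (cl Q x) z → cl Q (x *) z
    image⊆ z (y , y∈clx , refl) = cl-* x y y∈clx

    ⊆image : ∀ z → cl Q (x *) z → star-image Q (cl Q x) z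
    ⊆image z z∈clx* =
      z * , subst (λ w → cl Q w (z *)) (*-invol x) (cl-* (x *) z z∈clx*) , *-invol z

lemma3p4 : ∀ {c : Level} (Q : QBAlgebra c) (x : QBAlgebra.Carrier Q) →
    Regular Q x →
    SameSet Q (star-image Q (cl Q x)) (cl Q (QBAlgebra._* Q x))
lemma3p4 Q x _ = star-image-cl Q x
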